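{- Let $k\geq 2$ and let $\psi_1,\dots,\psi_5\in\Psi$ be five distinct linear forms. If $\Pi(\psi_1,\dots,\psi_5)$ has codimension at most $2$ in $\mathbb{R}^{2k}$, then three of $\psi_1,\dots,\psi_5$ share a common set of variables.
   Context: For $v\in\{1,\dots,k\}$ and $I\subset\{1,\dots,k\}$ let $\psi_{v,I}(\mathbf{x},\mathbf{y})=\sum_{i\in I}(v-i)x_i+\sum_{i\notin I}(v-i)y_i$ for $(\mathbf{x},\mathbf{y})\in\mathbb{R}^k\times\mathbb{R}^k$; $\Psi$ is the set of all such forms. Since $\psi_{v,I\cup\{v\}}=\psi_{v,I\setminus\{v\}}$, each $\psi\in\Psi$ can be written uniquely as $\psi=\psi_{v(\psi),I(\psi)}$ with $v(\psi)\in I(\psi)$. A collection of forms in $\Psi$ shares a common set of variables if there is $I\subset\{1,\dots,k\}$ with $I(\psi)=I\cup\{v(\psi)\}$ for every $\psi$ in the collection. $\Pi(\psi_1,\dots,\psi_s)$ is the linear subspace of $(\mathbf{x},\mathbf{y})$ on which $\psi_1,\dots,\psi_s$ all take the same value.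
   Formalization: The subspace $\Pi(\psi_1,\dots,\psi_5)$ and its codimension are taken in ℚ^(2k) instead of $\mathbb{R}^{2k}$, with rational points and rational linear functionals. -}

module Defs where

open import Data.Nat using (ℕ; zero; suc)
open import Data.Fin using (Fin; toℕ; zero; suc)
open import Data.Fin.Subset using (Subset; _∈_; _∪_; ⁅_⁆)
open import Data.Integer using (ℤ; +_; _-_)
open import Data.Rational using (ℚ; 0ℚ; _+_; _*_; _/_)
open import Data.Sum using (_⊎_; inj₁; inj₂)
open import Data.Product using (∃; _×_)
open import Data.Vec using (lookup)
open import Data.Bool using (if_then_else_)
open import Relation.Binary.PropositionalEquality using (_≡_)

-- Variables of R^k × R^k: inj₁ i is x_i, inj₂ i is y_i (indices i ∈ Fin k,
-- representing 1,…,k via i ↦ toℕ i + 1).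
Var : ℕ → Set
Var k = Fin k ⊎ Fin k

Vect : ℕ → Set
Vect k = Var k → ℚ

record Form (k : ℕ) : Set where
  constructor form
  field
    v   : Fin k
    I   : Subset k
    v∈I : v ∈ I
open Form public

-- the integer (v - i) (the +1 shifts cancel)
diff : ∀ {k} → Fin k → Fin k → ℚ
diff v i = (+ toℕ v - + toℕ i) / 1

coef : ∀ {k} → Form k → Vect k
coef ψ (inj₁ i) = if lookup (I ψ) i then diff (v ψ) i else 0ℚ
coef ψ (inj₂ i) = if lookup (I ψ) i then 0ℚ else diff (v ψ) i

sumFin : (n : ℕ) → (Fin n → ℚ) → ℚ
sumFin zero    f = 0ℚ
sumFin (suc n) f = f zero + sumFin n (λ i → f (suc i))

eval : ∀ {k} → Vect k → Vect k → ℚ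
eval {k} c p = sumFin k (λ i → c (inj₁ i) * p (inj₁ i))
             + sumFin k (λ i → c (inj₂ i) * p (inj₂ i))

Π : ∀ {k s} → (Fin (suc s) → Form k) → Vect k → Set
Π ψ p = ∀ j → eval (coef (ψ j)) p ≡ eval (coef (ψ zero)) p

-- a subspace S has codimension at most d iff it contains the common kernel
-- of d linear functionals
CodimAtMost : ∀ {k} → ℕ → (Vect k → Set) → Set
CodimAtMost {k} d S =
  ∃ λ (f : Fin d → Vect k) → ∀ p → (∀ j → eval (f j) p ≡ 0ℚ) → S p

Share3 : ∀ {k} → Form k → Form k → Form k → Set
Share3 {k} a b c = ∃ λ (J : Subset k) →
  (I a ≡ J ∪ ⁅ v a ⁆) × (I b ≡ J ∪ ⁅ v b ⁆) × (I c ≡ J ∪ ⁅ v c ⁆)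

{-# OPTIONS --safe #-}
-- Two forms ψ_{v,I}, ψ_{v′,I′} conflict at an index i ∉ {v, v′} if exactly one of I, I′ contains i;
-- three forms without pairwise conflicts share a common set of variables.  So if ψ₀, ψ₁, ψ₂ do not
-- share, two of them conflict at some i, and by pigeonhole three of the five forms, ψ_a, ψ_b, ψ_c,
-- agree on whether i ∈ I.  One form ψ_j of the conflicting pair disagrees with them, hence has a
-- nonzero coefficient on a variable g (x_i or y_i) on which ψ_a, ψ_b, ψ_c vanish.  If ψ_a, ψ_b, ψ_c
-- did not share, a conflict among them would likewise give ψ_q with a nonzero coefficient on a
-- variable h on which the other two, ψ_p and ψ_r, vanish, and ψ_r ≠ ψ_p differ on some variable t.
-- On the span of g, h, t the differences ψ_j − ψ_p, ψ_q − ψ_p, ψ_r − ψ_p are then triangular with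
-- nonzero diagonal, so they have no common zero there except 0; yet they vanish on Π, which meets
-- this 3-space nontrivially because Π has codimension at most 2.
module Submission where

open import Defs
open import Data.Nat using (ℕ; zero; suc; _≤_)
open import Data.Fin using (Fin; zero; suc; #_)
import Data.Fin.Properties as Fin
open import Data.Fin.Subset using (Subset; _∈_; _⊆_; _∪_; _∩_; ⁅_⁆)
open import Data.Fin.Subset.Properties
  using (⊆-antisym; p⊆p∪q; q⊆p∪q; x∈p∪q⁻; x∈⁅x⁆; x∈⁅y⁆⇒x≡y; p∩q⊆p; p∩q⊆q; x∈p∩q⁺)
open import Data.Vec using (lookup)
open import Data.Vec.Properties using ([]=⇒lookup; lookup⇒[]=)
open import Data.Bool using (Bool; true; false)
import Data.Bool.Properties as Bool
open import Data.Integer using (ℤ; 0ℤ; 1ℤ) renaming (_*_ to _*ℤ_)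
import Data.Integer.Properties as ℤ
open import Data.Integer.GCD using (gcd)
open import Data.Rational using (ℚ; 0ℚ; 1ℚ; _+_; _*_; _-_; -_; 1/_; _/_; ↥_; ≢-nonZero)
import Data.Rational.Properties as ℚ
open import Data.Rational.Solver using (module +-*-Solver)
open import Algebra.Bundles using (CommutativeRing)
open import Algebra.Properties.Semiring.Sum (CommutativeRing.semiring ℚ.+-*-commutativeRing)
  using (sum; sum-cong-≗; ∑-distrib-+; *-distribˡ-sum; *-distribʳ-sum)
open import Algebra.Properties.Group ℚ.+-0-group using () renaming (∙-cancelˡ to +-cancelˡ)
open import Algebra.Properties.CommutativeSemigroup (CommutativeRing.+-commutativeSemigroup ℚ.+-*-commutativeRing)
  using () renaming (interchange to +-interchange)
open import Data.Sum using (_⊎_; inj₁; inj₂; [_,_]′; map₁)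
open import Data.Product using (∃; _×_; _,_; proj₁; proj₂)
open import Data.Empty using (⊥; ⊥-elim)
open import Function using (_∘_; id)
open import Relation.Nullary using (¬_; yes; no)
open import Relation.Nullary.Decidable using (toSum)
open import Relation.Binary.PropositionalEquality
  using (_≡_; _≢_; refl; sym; trans; cong; cong₂; subst; module ≡-Reasoning)
open ≡-Reasoning

private variable
  k n : ℕ

sumFin≡sum : ∀ n (f : Fin n → ℚ) → sumFin n f ≡ sum f
sumFin≡sum zero    f = refl
sumFin≡sum (suc n) f = cong (f zero +_) (sumFin≡sum n (λ i → f (suc i)))

dot : (Fin n → ℚ) → (Fin n → ℚ) → ℚ
dot a p = sum (λ i → a i * p i)

x-part y-part : Vect k → Fin k → ℚ
x-part p i = p (inj₁ i)
y-part p i = p (inj₂ i)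

eval≡dot : ∀ (c p : Vect k) → eval c p ≡ dot (x-part c) (x-part p) + dot (y-part c) (y-part p)
eval≡dot {k} c p = cong₂ _+_ (sumFin≡sum k _) (sumFin≡sum k _)

dot-distribʳ-+ : ∀ (a p q : Fin n → ℚ) → dot a (λ i → p i + q i) ≡ dot a p + dot a q
dot-distribʳ-+ a p q = trans (sum-cong-≗ (λ i → ℚ.*-distribˡ-+ (a i) (p i) (q i))) (∑-distrib-+ (λ i → a i * p i) (λ i → a i * q i))

dot-scaleʳ : ∀ (a p : Fin n → ℚ) x → dot a (λ i → x * p i) ≡ x * dot a p
dot-scaleʳ a p x = begin
  sum (λ i → a i * (x * p i)) ≡⟨ sum-cong-≗ (λ i → swap (a i) (p i)) ⟩
  sum (λ i → x * (a i * p i)) ≡⟨ *-distribˡ-sum x (λ i → a i * p i) ⟨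
  x * dot a p                 ∎
  where
  open +-*-Solver
  swap : ∀ y z → y * (x * z) ≡ x * (y * z)
  swap = solve 3 (λ x y z → y :* (x :* z) := x :* (y :* z)) refl x

dot-zeroʳ : ∀ (a : Fin n → ℚ) → dot a (λ _ → 0ℚ) ≡ 0ℚ
dot-zeroʳ a = trans (sym (*-distribʳ-sum 0ℚ a)) (ℚ.*-zeroʳ (sum a))

kronecker : Fin n → Fin n → ℚ
kronecker zero    zero    = 1ℚ
kronecker zero    (suc _) = 0ℚ
kronecker (suc _) zero    = 0ℚ
kronecker (suc i) (suc j) = kronecker i j

dot-kronecker : ∀ (a : Fin n → ℚ) t → dot a (kronecker t) ≡ a t
dot-kronecker a zero = begin
  a zero * 1ℚ + dot (λ i → a (suc i)) (λ _ → 0ℚ) ≡⟨ cong₂ _+_ (ℚ.*-identityʳ (a zero)) (dot-zeroʳ (λ i → a (suc i))) ⟩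
  a zero + 0ℚ                                    ≡⟨ ℚ.+-identityʳ (a zero) ⟩
  a zero                                         ∎
dot-kronecker a (suc t) = begin
  a zero * 0ℚ + dot (λ i → a (suc i)) (kronecker t) ≡⟨ cong₂ _+_ (ℚ.*-zeroʳ (a zero)) (dot-kronecker (λ i → a (suc i)) t) ⟩
  0ℚ + a (suc t)                            ≡⟨ ℚ.+-identityˡ (a (suc t)) ⟩
  a (suc t)                                 ∎

unit : Var k → Vect k
unit (inj₁ i) (inj₁ j) = kronecker i j
unit (inj₂ i) (inj₂ j) = kronecker i j
unit _        _        = 0ℚ

eval-unit : ∀ (c : Vect k) t → eval c (unit t) ≡ c t
eval-unit c (inj₁ t) = begin
  eval c (unit (inj₁ t))                           ≡⟨ eval≡dot c (unit (inj₁ t)) ⟩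
  dot (x-part c) (kronecker t) + dot (y-part c) (λ _ → 0ℚ) ≡⟨ cong₂ _+_ (dot-kronecker (x-part c) t) (dot-zeroʳ (y-part c)) ⟩
  c (inj₁ t) + 0ℚ                                  ≡⟨ ℚ.+-identityʳ (c (inj₁ t)) ⟩
  c (inj₁ t)                                       ∎
eval-unit c (inj₂ t) = begin
  eval c (unit (inj₂ t))                           ≡⟨ eval≡dot c (unit (inj₂ t)) ⟩
  dot (x-part c) (λ _ → 0ℚ) + dot (y-part c) (kronecker t) ≡⟨ cong₂ _+_ (dot-zeroʳ (x-part c)) (dot-kronecker (y-part c) t) ⟩
  0ℚ + c (inj₂ t)                                  ≡⟨ ℚ.+-identityˡ (c (inj₂ t)) ⟩
  c (inj₂ t)                                       ∎

infixl 6 _⊕_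
infixr 7 _⊛_

_⊕_ : Vect k → Vect k → Vect k
(p ⊕ q) t = p t + q t

_⊛_ : ℚ → Vect k → Vect k
(x ⊛ p) t = x * p t

eval-⊕ : ∀ (c p q : Vect k) → eval c (p ⊕ q) ≡ eval c p + eval c q
eval-⊕ c p q = begin
  eval c (p ⊕ q)
    ≡⟨ eval≡dot c (p ⊕ q) ⟩
  dot c₁ (x-part (p ⊕ q)) + dot c₂ (y-part (p ⊕ q))
    ≡⟨ cong₂ _+_ (dot-distribʳ-+ c₁ (x-part p) (x-part q)) (dot-distribʳ-+ c₂ (y-part p) (y-part q)) ⟩
  (dot c₁ (x-part p) + dot c₁ (x-part q)) + (dot c₂ (y-part p) + dot c₂ (y-part q))
    ≡⟨ +-interchange (dot c₁ (x-part p)) (dot c₁ (x-part q)) (dot c₂ (y-part p)) (dot c₂ (y-part q)) ⟩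
  (dot c₁ (x-part p) + dot c₂ (y-part p)) + (dot c₁ (x-part q) + dot c₂ (y-part q))
    ≡⟨ cong₂ _+_ (eval≡dot c p) (eval≡dot c q) ⟨
  eval c p + eval c q
    ∎
  where c₁ = x-part c; c₂ = y-part c

eval-⊛ : ∀ (c : Vect k) x p → eval c (x ⊛ p) ≡ x * eval c p
eval-⊛ c x p = begin
  eval c (x ⊛ p)
    ≡⟨ eval≡dot c (x ⊛ p) ⟩
  dot c₁ (x-part (x ⊛ p)) + dot c₂ (y-part (x ⊛ p))
    ≡⟨ cong₂ _+_ (dot-scaleʳ c₁ (x-part p) x) (dot-scaleʳ c₂ (y-part p) x) ⟩
  x * dot c₁ (x-part p) + x * dot c₂ (y-part p)
    ≡⟨ ℚ.*-distribˡ-+ x (dot c₁ (x-part p)) (dot c₂ (y-part p)) ⟨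
  x * (dot c₁ (x-part p) + dot c₂ (y-part p))
    ≡⟨ cong (x *_) (eval≡dot c p) ⟨
  x * eval c p
    ∎
  where c₁ = x-part c; c₂ = y-part c

eval-combination : ∀ (c : Vect k) l₁ l₂ l₃ g h t →
  eval c (l₁ ⊛ unit g ⊕ l₂ ⊛ unit h ⊕ l₃ ⊛ unit t) ≡ l₁ * c g + l₂ * c h + l₃ * c t
eval-combination c l₁ l₂ l₃ g h t = begin
  eval c (l₁ ⊛ unit g ⊕ l₂ ⊛ unit h ⊕ l₃ ⊛ unit t)
    ≡⟨ eval-⊕ c (l₁ ⊛ unit g ⊕ l₂ ⊛ unit h) (l₃ ⊛ unit t) ⟩
  eval c (l₁ ⊛ unit g ⊕ l₂ ⊛ unit h) + eval c (l₃ ⊛ unit t)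
    ≡⟨ cong (_+ eval c (l₃ ⊛ unit t)) (eval-⊕ c (l₁ ⊛ unit g) (l₂ ⊛ unit h)) ⟩
  eval c (l₁ ⊛ unit g) + eval c (l₂ ⊛ unit h) + eval c (l₃ ⊛ unit t)
    ≡⟨ cong₂ _+_ (cong₂ _+_ (eval-⊛ c l₁ (unit g)) (eval-⊛ c l₂ (unit h))) (eval-⊛ c l₃ (unit t)) ⟩
  l₁ * eval c (unit g) + l₂ * eval c (unit h) + l₃ * eval c (unit t)
    ≡⟨ cong₂ _+_ (cong₂ _+_ (cong (l₁ *_) (eval-unit c g)) (cong (l₂ *_) (eval-unit c h))) (cong (l₃ *_) (eval-unit c t)) ⟩
  l₁ * c g + l₂ * c h + l₃ * c t
    ∎

x≢y⇒l*x≡l*y⇒l≡0 : ∀ l {x y} → x ≢ y → l * x ≡ l * y → l ≡ 0ℚ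
x≢y⇒l*x≡l*y⇒l≡0 l {x} {y} x≢y lx≡ly with l ℚ.≟ 0ℚ
... | yes l≡0 = l≡0
... | no  l≢0 = ⊥-elim (x≢y (begin
  x              ≡⟨ 1/l*l*z≡z x ⟨
  1/ l * (l * x) ≡⟨ cong (1/ l *_) lx≡ly ⟩
  1/ l * (l * y) ≡⟨ 1/l*l*z≡z y ⟩
  y              ∎))
  where
  instance _ = ≢-nonZero l≢0
  1/l*l*z≡z : ∀ z → 1/ l * (l * z) ≡ z
  1/l*l*z≡z z = trans (sym (ℚ.*-assoc (1/ l) l z)) (trans (cong (_* z) (ℚ.*-inverseˡ l)) (ℚ.*-identityˡ z))

drop-zero-term : ∀ {r s l x y} → l ≡ 0ℚ → r + l * x ≡ s + l * y → r ≡ s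
drop-zero-term {r} {s} {x = x} {y} refl eq = begin
  r           ≡⟨ r+0*z≡r r x ⟨
  r + 0ℚ * x  ≡⟨ eq ⟩
  s + 0ℚ * y  ≡⟨ r+0*z≡r s y ⟩
  s           ∎
  where
  r+0*z≡r : ∀ r z → r + 0ℚ * z ≡ r
  r+0*z≡r r z = trans (cong (r +_) (ℚ.*-zeroˡ z)) (ℚ.+-identityʳ r)

homogeneous-2×3-nontrivial : ∀ u₁ u₂ u₃ w₁ w₂ w₃ →
  ¬ (∀ l₁ l₂ l₃ → l₁ * u₁ + l₂ * u₂ + l₃ * u₃ ≡ 0ℚ → l₁ * w₁ + l₂ * w₂ + l₃ * w₃ ≡ 0ℚ →
     l₁ ≡ 0ℚ × l₂ ≡ 0ℚ × l₃ ≡ 0ℚ)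
homogeneous-2×3-nontrivial u₁ u₂ u₃ w₁ w₂ w₃ only-trivial =
  ℚ.1≢0 (proj₁ (only-trivial 1ℚ 0ℚ 0ℚ (first-column u₂ u₃ u₁≡0) (first-column w₂ w₃ w₁≡0)))
  where
  -- The solutions used: the cross product u × w, then (−u₂, u₁, 0) and (−w₂, w₁, 0), which force
  -- the first column to vanish, and finally (1, 0, 0).
  open +-*-Solver
  minor≡0 : u₁ * w₂ - u₂ * w₁ ≡ 0ℚ
  minor≡0 = proj₂ (proj₂ (only-trivial (u₂ * w₃ - u₃ * w₂) (u₃ * w₁ - u₁ * w₃) (u₁ * w₂ - u₂ * w₁)
    (solve 6 (λ u₁ u₂ u₃ w₁ w₂ w₃ →
      (u₂ :* w₃ :- u₃ :* w₂) :* u₁ :+ (u₃ :* w₁ :- u₁ :* w₃) :* u₂ :+ (u₁ :* w₂ :- u₂ :* w₁) :* u₃ := con 0ℚ)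
      refl u₁ u₂ u₃ w₁ w₂ w₃)
    (solve 6 (λ u₁ u₂ u₃ w₁ w₂ w₃ →
      (u₂ :* w₃ :- u₃ :* w₂) :* w₁ :+ (u₃ :* w₁ :- u₁ :* w₃) :* w₂ :+ (u₁ :* w₂ :- u₂ :* w₁) :* w₃ := con 0ℚ)
      refl u₁ u₂ u₃ w₁ w₂ w₃)))
  u₁≡0 : u₁ ≡ 0ℚ
  u₁≡0 = proj₁ (proj₂ (only-trivial (- u₂) u₁ 0ℚ
    (solve 3 (λ u₁ u₂ u₃ → :- u₂ :* u₁ :+ u₁ :* u₂ :+ con 0ℚ :* u₃ := con 0ℚ) refl u₁ u₂ u₃)
    (trans (solve 5 (λ u₁ u₂ w₁ w₂ w₃ → :- u₂ :* w₁ :+ u₁ :* w₂ :+ con 0ℚ :* w₃ := u₁ :* w₂ :- u₂ :* w₁)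
      refl u₁ u₂ w₁ w₂ w₃) minor≡0)))
  w₁≡0 : w₁ ≡ 0ℚ
  w₁≡0 = proj₁ (proj₂ (only-trivial (- w₂) w₁ 0ℚ
    (trans (solve 5 (λ u₁ u₂ u₃ w₁ w₂ → :- w₂ :* u₁ :+ w₁ :* u₂ :+ con 0ℚ :* u₃ := :- (u₁ :* w₂ :- u₂ :* w₁))
      refl u₁ u₂ u₃ w₁ w₂) (cong -_ minor≡0))
    (solve 3 (λ w₁ w₂ w₃ → :- w₂ :* w₁ :+ w₁ :* w₂ :+ con 0ℚ :* w₃ := con 0ℚ) refl w₁ w₂ w₃)))
  first-column : ∀ {a₁} a₂ a₃ → a₁ ≡ 0ℚ → 1ℚ * a₁ + 0ℚ * a₂ + 0ℚ * a₃ ≡ 0ℚ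
  first-column {a₁} a₂ a₃ a₁≡0 =
    trans (solve 3 (λ a₁ a₂ a₃ → con 1ℚ :* a₁ :+ con 0ℚ :* a₂ :+ con 0ℚ :* a₃ := a₁) refl a₁ a₂ a₃) a₁≡0

record Triangular (α β γ δ : Vect k) (g h t : Var k) : Set where
  field
    αg≢δg : α g ≢ δ g
    βg≡δg : β g ≡ δ g
    βh≢δh : β h ≢ δ h
    γg≡δg : γ g ≡ δ g
    γh≡δh : γ h ≡ δ h
    γt≢δt : γ t ≢ δ t

triangular⇒trivial : ∀ {α β γ δ : Vect k} {g h t} → Triangular α β γ δ g h t → ∀ {l₁ l₂ l₃} →
  let L = λ (ε : Vect k) → l₁ * ε g + l₂ * ε h + l₃ * ε t in
  L α ≡ L δ → L β ≡ L δ → L γ ≡ L δ → l₁ ≡ 0ℚ × l₂ ≡ 0ℚ × l₃ ≡ 0ℚ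
triangular⇒trivial {α = α} {β} {γ} {δ} {g} {h} {t} T {l₁} {l₂} {l₃} Lα Lβ Lγ = l₁≡0 , l₂≡0 , l₃≡0
  where
  open Triangular T
  l₃≡0 : l₃ ≡ 0ℚ
  l₃≡0 = x≢y⇒l*x≡l*y⇒l≡0 l₃ γt≢δt (+-cancelˡ (l₁ * δ g + l₂ * δ h) (l₃ * γ t) (l₃ * δ t) (begin
    l₁ * δ g + l₂ * δ h + l₃ * γ t ≡⟨ cong₂ (λ a b → l₁ * a + l₂ * b + l₃ * γ t) γg≡δg γh≡δh ⟨
    l₁ * γ g + l₂ * γ h + l₃ * γ t ≡⟨ Lγ ⟩
    l₁ * δ g + l₂ * δ h + l₃ * δ t ∎))
  l₂≡0 : l₂ ≡ 0ℚ
  l₂≡0 = x≢y⇒l*x≡l*y⇒l≡0 l₂ βh≢δh (+-cancelˡ (l₁ * δ g) (l₂ * β h) (l₂ * δ h) (begin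
    l₁ * δ g + l₂ * β h ≡⟨ cong (λ a → l₁ * a + l₂ * β h) βg≡δg ⟨
    l₁ * β g + l₂ * β h ≡⟨ drop-zero-term l₃≡0 Lβ ⟩
    l₁ * δ g + l₂ * δ h ∎))
  l₁≡0 : l₁ ≡ 0ℚ
  l₁≡0 = x≢y⇒l*x≡l*y⇒l≡0 l₁ αg≢δg (drop-zero-term l₂≡0 (drop-zero-term l₃≡0 Lα))

Coincide : ∀ {d} → (Fin d → Vect k) → Vect k → Vect k → Set
Coincide f α β = ∀ p → (∀ j → eval (f j) p ≡ 0ℚ) → eval α p ≡ eval β p

¬triangular-on-codim₂ : ∀ (f : Fin 2 → Vect k) {α β γ δ g h t} →
  Coincide f α δ → Coincide f β δ → Coincide f γ δ → ¬ Triangular α β γ δ g h t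
¬triangular-on-codim₂ f {α} {β} {γ} {δ} {g} {h} {t} α≈δ β≈δ γ≈δ T =
  homogeneous-2×3-nontrivial (u g) (u h) (u t) (w g) (w h) (w t) only-trivial
  where
  u w : Vect _
  u = f zero
  w = f (suc zero)
  only-trivial : ∀ l₁ l₂ l₃ → l₁ * u g + l₂ * u h + l₃ * u t ≡ 0ℚ → l₁ * w g + l₂ * w h + l₃ * w t ≡ 0ℚ →
                 l₁ ≡ 0ℚ × l₂ ≡ 0ℚ × l₃ ≡ 0ℚ
  only-trivial l₁ l₂ l₃ up≡0 wp≡0 = triangular⇒trivial T (at α α≈δ) (at β β≈δ) (at γ γ≈δ)
    where
    p = l₁ ⊛ unit g ⊕ l₂ ⊛ unit h ⊕ l₃ ⊛ unit t
    p∈ker : ∀ j → eval (f j) p ≡ 0ℚ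
    p∈ker zero       = trans (eval-combination u l₁ l₂ l₃ g h t) up≡0
    p∈ker (suc zero) = trans (eval-combination w l₁ l₂ l₃ g h t) wp≡0
    at : ∀ ε → Coincide f ε δ → l₁ * ε g + l₂ * ε h + l₃ * ε t ≡ l₁ * δ g + l₂ * δ h + l₃ * δ t
    at ε ε≈δ = begin
      l₁ * ε g + l₂ * ε h + l₃ * ε t ≡⟨ eval-combination ε l₁ l₂ l₃ g h t ⟨
      eval ε p                       ≡⟨ ε≈δ p p∈ker ⟩
      eval δ p                       ≡⟨ eval-combination δ l₁ l₂ l₃ g h t ⟩
      l₁ * δ g + l₂ * δ h + l₃ * δ t ∎

∀⊎∃ : ∀ {n} {P Q : Fin n → Set} → (∀ i → P i ⊎ Q i) → (∀ i → P i) ⊎ ∃ Q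
∀⊎∃ {zero}  P⊎Q = inj₁ λ ()
∀⊎∃ {suc n} P⊎Q with P⊎Q zero | ∀⊎∃ (P⊎Q ∘ suc)
... | inj₂ q₀ | _             = inj₂ (zero , q₀)
... | inj₁ _  | inj₂ (i , qᵢ) = inj₂ (suc i , qᵢ)
... | inj₁ p₀ | inj₁ pₛ       = inj₁ λ { zero → p₀ ; (suc i) → pₛ i }

∃-coordinate-≢ : ∀ (α β : Vect k) → ¬ (∀ t → α t ≡ β t) → ∃ λ t → α t ≢ β t
∃-coordinate-≢ α β α≉β with ∀⊎∃ (λ i → toSum (α (inj₁ i) ℚ.≟ β (inj₁ i)))
                          | ∀⊎∃ (λ i → toSum (α (inj₂ i) ℚ.≟ β (inj₂ i)))
... | inj₂ (i , ne) | _             = inj₁ i , ne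
... | inj₁ _        | inj₂ (i , ne) = inj₂ i , ne
... | inj₁ eqˣ      | inj₁ eqʸ      = ⊥-elim (α≉β λ { (inj₁ i) → eqˣ i ; (inj₂ i) → eqʸ i })

i/1≡0⇒i≡0 : ∀ i → i / 1 ≡ 0ℚ → i ≡ 0ℤ
i/1≡0⇒i≡0 i i/1≡0 = begin
  i                     ≡⟨ ℚ.↥-/ i 1 ⟨
  ↥ (i / 1) *ℤ gcd i 1ℤ ≡⟨ cong (λ q → ↥ q *ℤ gcd i 1ℤ) i/1≡0 ⟩
  0ℤ *ℤ gcd i 1ℤ        ≡⟨ ℤ.*-zeroˡ (gcd i 1ℤ) ⟩
  0ℤ                    ∎

diff≢0 : ∀ {a i : Fin k} → a ≢ i → diff a i ≢ 0ℚ
diff≢0 a≢i diff≡0 =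
  a≢i (Fin.toℕ-injective (ℤ.+-injective (ℤ.i-j≡0⇒i≡j _ _ (i/1≡0⇒i≡0 _ diff≡0))))

absent : Bool → Fin k → Var k
absent true  i = inj₂ i
absent false i = inj₁ i

coef-absent : ∀ (A : Form k) {i b} → lookup (I A) i ≡ b → coef A (absent b i) ≡ 0ℚ
coef-absent A {b = true}  Ai≡b rewrite Ai≡b = refl
coef-absent A {b = false} Ai≡b rewrite Ai≡b = refl

coef-absent-≢0 : ∀ (A : Form k) {i b} → v A ≢ i → lookup (I A) i ≢ b → coef A (absent b i) ≢ 0ℚ
coef-absent-≢0 A {i} {true}  vA≢i Ai≢b with lookup (I A) i
... | true  = ⊥-elim (Ai≢b refl)
... | false = diff≢0 vA≢i
coef-absent-≢0 A {i} {false} vA≢i Ai≢b with lookup (I A) i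
... | true  = diff≢0 vA≢i
... | false = ⊥-elim (Ai≢b refl)

AgreeAt : Fin k → Form k → Form k → Set
AgreeAt i A B = v A ≢ i → v B ≢ i → lookup (I A) i ≡ lookup (I B) i

Conflict : Fin k → Form k → Form k → Set
Conflict i A B = v A ≢ i × v B ≢ i × lookup (I A) i ≢ lookup (I B) i

agreeAt-or-conflict : ∀ i (A B : Form k) → AgreeAt i A B ⊎ Conflict i A B
agreeAt-or-conflict i A B with v A Fin.≟ i | v B Fin.≟ i | lookup (I A) i Bool.≟ lookup (I B) i
... | yes vA≡i | _        | _        = inj₁ λ vA≢i _ → ⊥-elim (vA≢i vA≡i)
... | no _     | yes vB≡i | _        = inj₁ λ _ vB≢i → ⊥-elim (vB≢i vB≡i)
... | no _     | no _     | yes Ai≡Bi = inj₁ λ _ _ → Ai≡Bi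
... | no vA≢i  | no vB≢i  | no Ai≢Bi  = inj₂ (vA≢i , vB≢i , Ai≢Bi)

∈-transport : ∀ {i} {A B : Form k} → AgreeAt i A B → v A ≢ i → i ∈ I A → i ∈ I B
∈-transport {i = i} {A} {B} agree vA≢i i∈A with v B Fin.≟ i
... | yes refl = v∈I B
... | no vB≢i  = lookup⇒[]= i (I B) (trans (sym (agree vA≢i vB≢i)) ([]=⇒lookup i∈A))

I≡J∪⁅v⁆ : ∀ (J : Subset k) (A : Form k) → J ⊆ I A → (∀ {i} → v A ≢ i → i ∈ I A → i ∈ J) →
          I A ≡ J ∪ ⁅ v A ⁆
I≡J∪⁅v⁆ J A J⊆A A-v⊆J = ⊆-antisym A⊆J∪v J∪v⊆A
  where
  A⊆J∪v : I A ⊆ J ∪ ⁅ v A ⁆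
  A⊆J∪v {i} i∈A with v A Fin.≟ i
  ... | yes refl = q⊆p∪q J ⁅ v A ⁆ (x∈⁅x⁆ (v A))
  ... | no vA≢i  = p⊆p∪q ⁅ v A ⁆ (A-v⊆J vA≢i i∈A)
  J∪v⊆A : J ∪ ⁅ v A ⁆ ⊆ I A
  J∪v⊆A {i} i∈J∪v with x∈p∪q⁻ J ⁅ v A ⁆ i∈J∪v
  ... | inj₁ i∈J = J⊆A i∈J
  ... | inj₂ i∈v = subst (_∈ I A) (sym (x∈⁅y⁆⇒x≡y (v A) i∈v)) (v∈I A)

agree⇒share3 : ∀ {A B C : Form k} → (∀ i → AgreeAt i A B) → (∀ i → AgreeAt i A C) → (∀ i → AgreeAt i B C) →
               Share3 A B C
agree⇒share3 {A = A} {B} {C} A~B A~C B~C =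
    J
  , I≡J∪⁅v⁆ J A (p∩q⊆p _ _) (into A (λ _ _ _ → refl) A~B A~C)
  , I≡J∪⁅v⁆ J B (p∩q⊆p _ _ ∘ p∩q⊆q _ _) (into B (sym′ {A} {B} A~B) (λ _ _ _ → refl) B~C)
  , I≡J∪⁅v⁆ J C (p∩q⊆q _ _ ∘ p∩q⊆q _ _) (into C (sym′ {A} {C} A~C) (sym′ {B} {C} B~C) (λ _ _ _ → refl))
  where
  -- Intersecting is harmless because v X ∈ I X for every form X.
  J : Subset _
  J = I A ∩ I B ∩ I C
  sym′ : ∀ {X Y} → (∀ i → AgreeAt i X Y) → ∀ i → AgreeAt i Y X
  sym′ X~Y i vY≢i vX≢i = sym (X~Y i vX≢i vY≢i)
  into : ∀ X → (∀ i → AgreeAt i X A) → (∀ i → AgreeAt i X B) → (∀ i → AgreeAt i X C) →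
         ∀ {i} → v X ≢ i → i ∈ I X → i ∈ J
  into X X~A X~B X~C vX≢i i∈X =
    x∈p∩q⁺ (∈-transport {A = X} {A} (X~A _) vX≢i i∈X
           , x∈p∩q⁺ (∈-transport {A = X} {B} (X~B _) vX≢i i∈X , ∈-transport {A = X} {C} (X~C _) vX≢i i∈X))

agreeAt₃-or-conflict : ∀ (A B C : Form k) i →
  (AgreeAt i A B × AgreeAt i A C × AgreeAt i B C) ⊎ (Conflict i A B ⊎ Conflict i A C ⊎ Conflict i B C)
agreeAt₃-or-conflict A B C i with agreeAt-or-conflict i A B | agreeAt-or-conflict i A C | agreeAt-or-conflict i B C
... | inj₂ c  | _       | _       = inj₂ (inj₁ c)
... | inj₁ _  | inj₂ c  | _       = inj₂ (inj₂ (inj₁ c))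
... | inj₁ _  | inj₁ _  | inj₂ c  = inj₂ (inj₂ (inj₂ c))
... | inj₁ ab | inj₁ ac | inj₁ bc = inj₁ (ab , ac , bc)

share3-or-conflict : ∀ (A B C : Form k) →
  Share3 A B C ⊎ ∃ λ i → Conflict i A B ⊎ Conflict i A C ⊎ Conflict i B C
share3-or-conflict A B C = map₁ share (∀⊎∃ (agreeAt₃-or-conflict A B C))
  where
  share : (∀ i → AgreeAt i A B × AgreeAt i A C × AgreeAt i B C) → Share3 A B C
  share agree = agree⇒share3 {A = A} {B} {C} (proj₁ ∘ agree) (proj₁ ∘ proj₂ ∘ agree) (proj₂ ∘ proj₂ ∘ agree)

conflict⇒bit≢ : ∀ (ψ : Fin n → Form k) {i x y} β → Conflict i (ψ x) (ψ y) →
                ∃ λ j → v (ψ j) ≢ i × lookup (I (ψ j)) i ≢ β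
conflict⇒bit≢ ψ {i} {x} {y} β (vx≢i , vy≢i , xi≢yi) with lookup (I (ψ x)) i Bool.≟ β
... | yes xi≡β = y , vy≢i , λ yi≡β → xi≢yi (trans xi≡β (sym yi≡β))
... | no  xi≢β = x , vx≢i , xi≢β

record Triple {n} (P : Fin n → Set) : Set where
  constructor triple
  field
    a b c : Fin n
    a≢b : a ≢ b
    a≢c : a ≢ c
    b≢c : b ≢ c
    Pa : P a
    Pb : P b
    Pc : P c

pigeonhole₅ : ∀ (χ : Fin 5 → Bool) → ∃ λ b → Triple (λ a → χ a ≡ b)
pigeonhole₅ χ with χ (# 0) in e₀ | χ (# 1) in e₁ | χ (# 2) in e₂ | χ (# 3) in e₃ | χ (# 4) in e₄
... | true  | true  | true  | _     | _     = true  , triple (# 0) (# 1) (# 2) (λ ()) (λ ()) (λ ()) e₀ e₁ e₂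
... | true  | true  | _     | true  | _     = true  , triple (# 0) (# 1) (# 3) (λ ()) (λ ()) (λ ()) e₀ e₁ e₃
... | true  | true  | _     | _     | true  = true  , triple (# 0) (# 1) (# 4) (λ ()) (λ ()) (λ ()) e₀ e₁ e₄
... | true  | _     | true  | true  | _     = true  , triple (# 0) (# 2) (# 3) (λ ()) (λ ()) (λ ()) e₀ e₂ e₃
... | true  | _     | true  | _     | true  = true  , triple (# 0) (# 2) (# 4) (λ ()) (λ ()) (λ ()) e₀ e₂ e₄
... | true  | _     | _     | true  | true  = true  , triple (# 0) (# 3) (# 4) (λ ()) (λ ()) (λ ()) e₀ e₃ e₄
... | _     | true  | true  | true  | _     = true  , triple (# 1) (# 2) (# 3) (λ ()) (λ ()) (λ ()) e₁ e₂ e₃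
... | _     | true  | true  | _     | true  = true  , triple (# 1) (# 2) (# 4) (λ ()) (λ ()) (λ ()) e₁ e₂ e₄
... | _     | true  | _     | true  | true  = true  , triple (# 1) (# 3) (# 4) (λ ()) (λ ()) (λ ()) e₁ e₃ e₄
... | _     | _     | true  | true  | true  = true  , triple (# 2) (# 3) (# 4) (λ ()) (λ ()) (λ ()) e₂ e₃ e₄
... | false | false | false | _     | _     = false , triple (# 0) (# 1) (# 2) (λ ()) (λ ()) (λ ()) e₀ e₁ e₂
... | false | false | _     | false | _     = false , triple (# 0) (# 1) (# 3) (λ ()) (λ ()) (λ ()) e₀ e₁ e₃
... | false | false | _     | _     | false = false , triple (# 0) (# 1) (# 4) (λ ()) (λ ()) (λ ()) e₀ e₁ e₄
... | false | _     | false | false | _     = false , triple (# 0) (# 2) (# 3) (λ ()) (λ ()) (λ ()) e₀ e₂ e₃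
... | false | _     | false | _     | false = false , triple (# 0) (# 2) (# 4) (λ ()) (λ ()) (λ ()) e₀ e₂ e₄
... | false | _     | _     | false | false = false , triple (# 0) (# 3) (# 4) (λ ()) (λ ()) (λ ()) e₀ e₃ e₄
... | _     | false | false | false | _     = false , triple (# 1) (# 2) (# 3) (λ ()) (λ ()) (λ ()) e₁ e₂ e₃
... | _     | false | false | _     | false = false , triple (# 1) (# 2) (# 4) (λ ()) (λ ()) (λ ()) e₁ e₂ e₄
... | _     | false | _     | false | false = false , triple (# 1) (# 3) (# 4) (λ ()) (λ ()) (λ ()) e₁ e₃ e₄
... | _     | _     | false | false | false = false , triple (# 2) (# 3) (# 4) (λ ()) (λ ()) (λ ()) e₂ e₃ e₄

Π⇒coincide : ∀ {s d} (ψ : Fin (suc s) → Form k) (f : Fin d → Vect k) →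
  (∀ p → (∀ j → eval (f j) p ≡ 0ℚ) → Π ψ p) → ∀ a b → Coincide f (coef (ψ a)) (coef (ψ b))
Π⇒coincide ψ f ker⊆Π a b p p∈ker = trans (ker⊆Π p p∈ker a) (sym (ker⊆Π p p∈ker b))

module Codim₂Family {k n} (ψ : Fin n → Form k) (f : Fin 2 → Vect k)
  (coincide : ∀ a b → Coincide f (coef (ψ a)) (coef (ψ b)))
  (distinct : ∀ a b → a ≢ b → ¬ (∀ t → coef (ψ a) t ≡ coef (ψ b) t)) where

  odd-one-out⇒⊥ : ∀ {i} j p q r g → coef (ψ j) g ≢ 0ℚ →
    coef (ψ p) g ≡ 0ℚ → coef (ψ q) g ≡ 0ℚ → coef (ψ r) g ≡ 0ℚ → p ≢ r →
    v (ψ q) ≢ i → lookup (I (ψ q)) i ≢ lookup (I (ψ p)) i → lookup (I (ψ r)) i ≡ lookup (I (ψ p)) i → ⊥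
  odd-one-out⇒⊥ {i} j p q r g jg≢0 pg≡0 qg≡0 rg≡0 p≢r vq≢i qi≢pi ri≡pi =
    ¬triangular-on-codim₂ f (coincide j p) (coincide q p) (coincide r p) triangular
    where
    h = absent (lookup (I (ψ p)) i) i
    separating = ∃-coordinate-≢ (coef (ψ r)) (coef (ψ p)) (distinct r p (p≢r ∘ sym))
    triangular : Triangular (coef (ψ j)) (coef (ψ q)) (coef (ψ r)) (coef (ψ p)) g h (proj₁ separating)
    triangular = record
      { αg≢δg = λ jg≡pg → jg≢0 (trans jg≡pg pg≡0)
      ; βg≡δg = trans qg≡0 (sym pg≡0)
      ; βh≢δh = λ qh≡ph → coef-absent-≢0 (ψ q) vq≢i qi≢pi (trans qh≡ph (coef-absent (ψ p) refl))
      ; γg≡δg = trans rg≡0 (sym pg≡0)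
      ; γh≡δh = trans (coef-absent (ψ r) ri≡pi) (sym (coef-absent (ψ p) refl))
      ; γt≢δt = proj₂ separating
      }

  conflict⇒⊥ : ∀ {i} j x y z g → coef (ψ j) g ≢ 0ℚ →
    coef (ψ x) g ≡ 0ℚ → coef (ψ y) g ≡ 0ℚ → coef (ψ z) g ≡ 0ℚ → x ≢ z → y ≢ z →
    ¬ Conflict i (ψ x) (ψ y)
  -- ψ z agrees at i with ψ x or with ψ y; the other one is the odd one out.
  conflict⇒⊥ {i} j x y z g jg≢0 xg≡0 yg≡0 zg≡0 x≢z y≢z (vx≢i , vy≢i , xi≢yi)
    with lookup (I (ψ z)) i Bool.≟ lookup (I (ψ x)) i
  ... | yes zi≡xi = odd-one-out⇒⊥ j x y z g jg≢0 xg≡0 yg≡0 zg≡0 x≢z vy≢i (xi≢yi ∘ sym) zi≡xi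
  ... | no  zi≢xi = odd-one-out⇒⊥ j y x z g jg≢0 yg≡0 xg≡0 zg≡0 y≢z vx≢i xi≢yi
                      (trans (Bool.¬-not zi≢xi) (sym (Bool.¬-not (xi≢yi ∘ sym))))

  triple-shares : ∀ {i β} (T : Triple (λ a → lookup (I (ψ a)) i ≡ β)) j → v (ψ j) ≢ i → lookup (I (ψ j)) i ≢ β →
    let open Triple T in Share3 (ψ a) (ψ b) (ψ c)
  triple-shares {i} {β} T j vj≢i ji≢β =
    [ id , ⊥-elim ∘ no-conflict ∘ proj₂ ]′ (share3-or-conflict (ψ a) (ψ b) (ψ c))
    where
    open Triple T
    g = absent β i
    jg≢0 = coef-absent-≢0 (ψ j) vj≢i ji≢β
    ag≡0 = coef-absent (ψ a) Pa
    bg≡0 = coef-absent (ψ b) Pb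
    cg≡0 = coef-absent (ψ c) Pc
    no-conflict : ∀ {i′} → ¬ (Conflict i′ (ψ a) (ψ b) ⊎ Conflict i′ (ψ a) (ψ c) ⊎ Conflict i′ (ψ b) (ψ c))
    no-conflict (inj₁ ab)        = conflict⇒⊥ j a b c g jg≢0 ag≡0 bg≡0 cg≡0 a≢c b≢c ab
    no-conflict (inj₂ (inj₁ ac)) = conflict⇒⊥ j a c b g jg≢0 ag≡0 cg≡0 bg≡0 a≢b (b≢c ∘ sym) ac
    no-conflict (inj₂ (inj₂ bc)) = conflict⇒⊥ j b c a g jg≢0 bg≡0 cg≡0 ag≡0 (a≢b ∘ sym) (a≢c ∘ sym) bc

lemma6p4 : (k : ℕ) → 2 ≤ k → (ψ : Fin 5 → Form k)
    → (∀ a b → a ≢ b → ¬ (∀ x → coef (ψ a) x ≡ coef (ψ b) x))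
    → CodimAtMost 2 (Π ψ)
    → ∃ λ a → ∃ λ b → ∃ λ c → (a ≢ b) × (a ≢ c) × (b ≢ c) × Share3 (ψ a) (ψ b) (ψ c)
lemma6p4 k _ ψ distinct (f , ker⊆Π) with share3-or-conflict (ψ (# 0)) (ψ (# 1)) (ψ (# 2))
... | inj₁ shared = # 0 , # 1 , # 2 , (λ ()) , (λ ()) , (λ ()) , shared
... | inj₂ (i , conflict) with pigeonhole₅ (λ a → lookup (I (ψ a)) i)
...   | β , T with [ conflict⇒bit≢ ψ β , [ conflict⇒bit≢ ψ β , conflict⇒bit≢ ψ β ]′ ]′ conflict
...     | j , vj≢i , ji≢β = a , b , c , a≢b , a≢c , b≢c , triple-shares T j vj≢i ji≢β
  where
  open Triple T
  open Codim₂Family ψ f (Π⇒coincide ψ f ker⊆Π) distinct
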